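{- Let $\pi\in S_n$ be chosen uniformly at random, let $\sigma\in S_m$ with $m\le n$, and for $0\le i\le n-m$ let $A_i$ be the event $\mathrm{st}(\pi_{i+1},\dots,\pi_{i+m})=\sigma$. Let $S,T\subseteq\{0,1,\dots,n-m\}$ be disjoint sets such that $|i-j|\ge m$ for all $i\in S$ and $j\in T$. Then the family of events $\{A_i\}_{i\in S}$ is independent of the family $\{A_j\}_{j\in T}$; that is, for all disjoint $S^+,S^-\subseteq S$ and disjoint $T^+,T^-\subseteq T$ (with the conditioning event of positive probability), $$\Pr\Big(\bigcap_{i\in S^+}A_i\cap\bigcap_{i\in S^- }\overline{A_i}\;\Big|\;\bigcap_{j\in T^+}A_j\cap\bigcap_{j\in T^- }\overline{A_j}\Big)=\Pr\Big(\bigcap_{i\in S^+}A_i\cap\bigcap_{i\in S^- }\overline{A_i}\Big).$$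
   Context: $S_n$ denotes the set of permutations of $\{1,\dots,n\}$. For distinct integers $x_1,\dots,x_k$, $\mathrm{st}(x_1,\dots,x_k)\in S_k$ is the permutation obtained by replacing each entry by its rank among $x_1,\dots,x_k$. -}

module Defs where

open import Data.Nat using (ℕ; zero; suc; _≡ᵇ_; _<ᵇ_; _!)
open import Data.Nat.Properties using (_!≢0)
open import Data.Bool using (Bool; true; false; _∧_; not)
open import Data.List using (List; []; _∷_; [_]; map; concatMap; applyUpTo; filterᵇ; length; take; drop)
open import Data.Bool.ListAction using (all; any)
open import Data.Integer using (+_)
open import Data.Rational using (ℚ; _/_; _÷_; NonZero)

words : ℕ → ℕ → List (List ℕ)
words n zero    = [ [] ]
words n (suc k) = concatMap (λ w → map (λ x → x ∷ w) (applyUpTo suc n)) (words n k)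

memᵇ : ℕ → List ℕ → Bool
memᵇ x = any (λ y → x ≡ᵇ y)

-- a word of length n over {1,…,n} is a permutation iff every j ∈ {1,…,n} occurs in it
isPermᵇ : ℕ → List ℕ → Bool
isPermᵇ n w = all (λ j → memᵇ j w) (applyUpTo suc n)

-- S_n : all permutations of {1,…,n}, in one-line notation π = [π₁,…,πₙ]
Sym : ℕ → List (List ℕ)
Sym n = filterᵇ (isPermᵇ n) (words n n)

countᵇ : {A : Set} → (A → Bool) → List A → ℕ
countᵇ p xs = length (filterᵇ p xs)

st : List ℕ → List ℕ
st xs = map (λ x → suc (countᵇ (λ y → y <ᵇ x) xs)) xs

_==ᴸ_ : List ℕ → List ℕ → Bool
[]       ==ᴸ []       = true
(x ∷ xs) ==ᴸ (y ∷ ys) = (x ≡ᵇ y) ∧ (xs ==ᴸ ys)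
_        ==ᴸ _        = false

-- the event A_i : st(π_{i+1},…,π_{i+m}) = σ   (m = length of the pattern σ ∈ S_m)
A : (m : ℕ) → List ℕ → ℕ → List ℕ → Bool
A m σ i π = st (take m (drop i π)) ==ᴸ σ

Ev : (m : ℕ) → List ℕ → List ℕ → List ℕ → List ℕ → Bool
Ev m σ P N π = all (λ i → A m σ i π) P ∧ all (λ i → not (A m σ i π)) N

-- uniform probability on S_n (|S_n| = n!)
Pr : (n : ℕ) → (List ℕ → Bool) → ℚ
Pr n E = _/_ (+ countᵇ E (Sym n)) (n !) {{n !≢0}}

CondPr : (n : ℕ) → (E F : List ℕ → Bool) → .{{NonZero (Pr n F)}} → ℚ
CondPr n E F = Pr n (λ π → E π ∧ F π) ÷ Pr n F

module Submission where

open import Defs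
import Data.Nat as ℕ
open import Data.Nat
  using (ℕ; zero; suc; _+_; _*_; _≤_; _<_; z≤n; s≤s; _∸_; _⊓_; ∣_-_∣; _≡ᵇ_; _<ᵇ_; _≤ᵇ_; _!)
open import Data.Nat.Properties
  using (_≟_; _<?_; _!≢0; suc-injective; *-assoc; +-monoʳ-<; m≤m+n; n<1+n; m≤n⇒m<n∨m≡n; m⊓n≤m; m⊓n≤n;
         ≤-refl; ≤-reflexive; ≤-trans; ≤-antisym; ≤-pred; <-irrefl; <-trans; <-≤-trans; ≤-<-trans;
         <-≤-connex; <-cmp; ≮⇒≥; <⇒≱; m≤n⇒m≤1+n; m<n⇒m<1+n;
         ≡ᵇ⇒≡; ≡⇒≡ᵇ; <⇒<ᵇ; <ᵇ⇒<; ≤ᵇ⇒≤; ≤⇒≤ᵇ)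
open import Data.Bool using (Bool; true; false; not; _∧_; T; T?; if_then_else_)
open import Data.Bool.Properties using (T-≡; ∧-identityʳ)
open import Data.Bool.ListAction using (all; any)
open import Data.List
  using (List; []; _∷_; map; filter; filterᵇ; length; _++_; take; drop; applyUpTo; upTo; cartesianProduct)
open import Data.List.Properties
  using (filter-notAll; filter-all; length-map; length-applyUpTo; length-upTo; map-upTo; length-take;
         length-drop; length-++-sucʳ; length-++-≤ˡ; ∷-injectiveˡ; ∷-injectiveʳ; ≡-dec)
open import Data.List.Membership.Propositional using (_∈_; _∉_)
open import Data.List.Membership.Propositional.Properties
  using (∈-filter⁺; ∈-filter⁻; ∈-map⁺; ∈-map⁻; ∈-concat⁺′; ∈-concat⁻′; ∈-applyUpTo⁺; ∈-applyUpTo⁻;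
         ∈-upTo⁺; ∈-upTo⁻; ∈-cartesianProduct⁺; ∈-cartesianProduct⁻; ∈-++⁺ˡ; ∈-++⁻; ∈-∃++)
open import Data.List.Relation.Unary.Any using (Any; here; there)
open import Data.List.Relation.Unary.All using (All; []; _∷_)
import Data.List.Relation.Unary.All as All
import Data.List.Relation.Unary.All.Properties as All
open import Data.List.Relation.Unary.AllPairs using ([]; _∷_)
import Data.List.Relation.Unary.AllPairs as AllPairs
import Data.List.Relation.Unary.AllPairs.Properties as AllPairs
open import Data.List.Relation.Unary.Unique.Propositional using (Unique)
open import Data.List.Relation.Unary.Unique.Propositional.Properties
  using (filter⁺; map⁺; concat⁺; applyUpTo⁺₁; upTo⁺; cartesianProduct⁺)
open import Data.List.Relation.Binary.Subset.Propositional using (_⊆_)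
open import Data.Product using (_×_; _,_; proj₁; proj₂; ∃; ∃₂)
import Data.Product as Product
open import Data.Product.Properties using () renaming (≡-dec to ×-≡-dec)
open import Data.Sum using (_⊎_; inj₁; inj₂; [_,_]′)
import Data.Sum as Sum
open import Data.Empty using (⊥; ⊥-elim)
open import Data.Integer using (+_)
import Data.Integer as ℤ
import Data.Integer.Properties as ℤ
open import Data.Rational using (NonZero)
import Data.Rational as ℚ
import Data.Rational.Properties as ℚ
import Data.Rational.Unnormalised as ℚᵘ
import Data.Rational.Unnormalised.Properties as ℚᵘ
open import Function using (_∘_; id; Equivalence)
open import Relation.Nullary using (¬_; yes; no; ¬?)
open import Relation.Binary.Definitions using (DecidableEquality; tri<; tri≈; tri>)
open import Relation.Binary.PropositionalEquality
  using (_≡_; _≢_; refl; sym; trans; cong; cong₂; subst; module ≡-Reasoning)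

-- Write E = Ev m σ S⁺ S⁻ and F = Ev m σ T⁺ T⁻, and #G for the number of
-- permutations in Sym n satisfying G.  Since Pr n G = #G / n!, the claim
-- CondPr n E F = Pr n E reduces to the product rule  #(E ∧ F) · n! = #E · #F,
-- together with |Sym n| = n!.
--
-- Call a position covered if it lies in a window [j, j+m) with j ∈ T; by the
-- separation hypothesis no window [i, i+m) with i ∈ S contains a covered
-- position.  For permutations π, ρ, the graft of ρ into π keeps π at uncovered
-- positions and rearranges π's covered values into the relative order of ρ.
-- It is a permutation with the S-events of π and the T-events of ρ, and
-- (π, ρ) ↦ (graft π ρ, graft ρ π) is an involution of Sym n × Sym n carrying
-- the pairs with E π ∧ F ρ onto those with E π ∧ F π.  Counting both sets of
-- pairs gives the product rule.

∧-true⁻ : ∀ {a b} → a ∧ b ≡ true → a ≡ true × b ≡ true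
∧-true⁻ {true} {true} _ = refl , refl

all-true⁻ : ∀ {X : Set} (p : X → Bool) {xs x} → all p xs ≡ true → x ∈ xs → p x ≡ true
all-true⁻ p {y ∷ ys} e (here refl) = proj₁ (∧-true⁻ e)
all-true⁻ p {y ∷ ys} e (there x∈) = all-true⁻ p (proj₂ (∧-true⁻ {p y} e)) x∈

all-true⁺ : ∀ {X : Set} (p : X → Bool) xs → (∀ {x} → x ∈ xs → p x ≡ true) → all p xs ≡ true
all-true⁺ p []       h = refl
all-true⁺ p (y ∷ ys) h rewrite h (here refl) = all-true⁺ p ys (λ x∈ → h (there x∈))

any-true⁻ : ∀ {X : Set} (p : X → Bool) xs → any p xs ≡ true → ∃ λ x → x ∈ xs × p x ≡ true
any-true⁻ p (y ∷ ys) e with p y in py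
... | true  = y , here refl , py
... | false = let x , x∈ , px = any-true⁻ p ys e in x , there x∈ , px

any-true⁺ : ∀ {X : Set} (p : X → Bool) {xs x} → x ∈ xs → p x ≡ true → any p xs ≡ true
any-true⁺ p {y ∷ ys} (here refl) e rewrite e = refl
any-true⁺ p {y ∷ ys} (there x∈) e with p y
... | true  = refl
... | false = any-true⁺ p x∈ e

any-false : ∀ {X : Set} (p : X → Bool) xs → (∀ {x} → x ∈ xs → p x ≡ false) → any p xs ≡ false
any-false p []       h = refl
any-false p (x ∷ xs) h rewrite h (here refl) = any-false p xs (λ x∈ → h (there x∈))

all-cong : ∀ {X : Set} (p q : X → Bool) xs → (∀ {x} → x ∈ xs → p x ≡ q x) → all p xs ≡ all q xs
all-cong p q []       h = refl
all-cong p q (x ∷ xs) h = cong₂ _∧_ (h (here refl)) (all-cong p q xs (λ x∈ → h (there x∈)))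

∈-filterᵇ⁺ : ∀ {X : Set} (p : X → Bool) {x xs} → x ∈ xs → p x ≡ true → x ∈ filterᵇ p xs
∈-filterᵇ⁺ p x∈ px = ∈-filter⁺ (T? ∘ p) x∈ (Equivalence.from T-≡ px)

∈-filterᵇ⁻ : ∀ {X : Set} (p : X → Bool) {x} xs → x ∈ filterᵇ p xs → x ∈ xs × p x ≡ true
∈-filterᵇ⁻ p xs x∈ with ∈-filter⁻ (T? ∘ p) {xs = xs} x∈
... | x∈xs , px = x∈xs , Equivalence.to T-≡ px

count-cong : ∀ {X : Set} (p q : X → Bool) {xs : List X} →
             (∀ {x} → x ∈ xs → p x ≡ q x) → countᵇ p xs ≡ countᵇ q xs
count-cong p q {[]}     h = refl
count-cong p q {x ∷ xs} h with p x | q x | h (here refl)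
... | true  | true  | _ = cong suc (count-cong p q (λ x∈ → h (there x∈)))
... | false | false | _ = count-cong p q (λ x∈ → h (there x∈))

count-++ : ∀ {X : Set} (p : X → Bool) xs ys → countᵇ p (xs ++ ys) ≡ countᵇ p xs + countᵇ p ys
count-++ p []       ys = refl
count-++ p (x ∷ xs) ys with p x
... | true  = cong suc (count-++ p xs ys)
... | false = count-++ p xs ys

count-map : ∀ {X Y : Set} (p : Y → Bool) (f : X → Y) xs → countᵇ p (map f xs) ≡ countᵇ (λ x → p (f x)) xs
count-map p f []       = refl
count-map p f (x ∷ xs) with p (f x)
... | true  = cong suc (count-map p f xs)
... | false = count-map p f xs

count-true : ∀ {X : Set} (xs : List X) → countᵇ (λ _ → true) xs ≡ length xs
count-true []       = refl
count-true (x ∷ xs) = cong suc (count-true xs)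

count-product : ∀ {X Y : Set} (f : X → Bool) (g : Y → Bool) xs ys →
  countᵇ (λ xy → f (proj₁ xy) ∧ g (proj₂ xy)) (cartesianProduct xs ys) ≡ countᵇ f xs * countᵇ g ys
count-product f g []       ys = refl
count-product f g (x ∷ xs) ys =
  trans (count-++ _ (map (x ,_) ys) (cartesianProduct xs ys))
        (trans (cong₂ _+_ (count-map _ (x ,_) ys) (count-product f g xs ys)) (row (f x) refl))
  where
  none : ∀ (zs : List _) → countᵇ (λ _ → false) zs ≡ 0
  none []       = refl
  none (z ∷ zs) = none zs
  row : ∀ b → f x ≡ b → countᵇ (λ y → b ∧ g y) ys + countᵇ f xs * countᵇ g ys ≡ countᵇ f (x ∷ xs) * countᵇ g ys
  row true  e rewrite e = refl
  row false e rewrite e = cong (_+ countᵇ f xs * countᵇ g ys) (none ys)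

count-mono : ∀ {X : Set} (p q : X → Bool) xs → (∀ y → p y ≡ true → q y ≡ true) → countᵇ p xs ≤ countᵇ q xs
count-mono p q []       h = z≤n
count-mono p q (y ∷ xs) h with p y in py | q y in qy
... | true  | true  = s≤s (count-mono p q xs h)
... | false | true  = m≤n⇒m≤1+n (count-mono p q xs h)
... | false | false = count-mono p q xs h
... | true  | false with trans (sym (h y py)) qy
... | ()

count-strict : ∀ {X : Set} (p q : X → Bool) xs {z} → z ∈ xs → p z ≡ false → q z ≡ true →
               (∀ y → p y ≡ true → q y ≡ true) → countᵇ p xs < countᵇ q xs
count-strict p q (y ∷ xs) (here refl) pz qz h rewrite pz | qz = s≤s (count-mono p q xs h)
count-strict p q (y ∷ xs) (there z∈) pz qz h with p y in py | q y in qy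
... | true  | true  = s≤s (count-strict p q xs z∈ pz qz h)
... | false | true  = m<n⇒m<1+n (count-strict p q xs z∈ pz qz h)
... | false | false = count-strict p q xs z∈ pz qz h
... | true  | false with trans (sym (h y py)) qy
... | ()

module Pigeonhole {X : Set} (_≟_ : DecidableEquality X) where

  open import Data.List.Membership.DecPropositional _≟_ using (_∈?_)

  remove : X → List X → List X
  remove x = filter (λ y → ¬? (x ≟ y))

  remove-shorter : ∀ {x ys} → x ∈ ys → length (remove x ys) < length ys
  remove-shorter {x} {ys} x∈ = filter-notAll _ ys (occurs x∈)
    where
    occurs : ∀ {zs} → x ∈ zs → Any (λ y → ¬ ¬ (x ≡ y)) zs
    occurs (here refl) = here (λ x≢x → x≢x refl)
    occurs (there x∈) = there (occurs x∈)

  remove-keeps : ∀ {x y ys} → y ∈ ys → x ≢ y → y ∈ remove x ys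
  remove-keeps y∈ x≢y = ∈-filter⁺ _ y∈ x≢y

  remove-length : ∀ {x ys} → Unique ys → length ys ≤ suc (length (remove x ys))
  remove-length {x} {[]}     u = z≤n
  remove-length {x} {y ∷ ys} (y∉ys ∷ u) with x ≟ y
  ... | yes refl = s≤s (≤-reflexive (cong length (sym (filter-all _ y∉ys))))
  ... | no _     = s≤s (remove-length u)

  ∉⇒All≢ : ∀ {x : X} {xs} → x ∉ xs → All (x ≢_) xs
  ∉⇒All≢ {xs = []}     _   = []
  ∉⇒All≢ {xs = y ∷ ys} x∉ = (λ e → x∉ (here e)) ∷ ∉⇒All≢ (λ x∈ → x∉ (there x∈))

  All≢⇒∉ : ∀ {x : X} {xs} → All (x ≢_) xs → x ∉ xs
  All≢⇒∉ (x≢y ∷ _)  (here refl) = x≢y refl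
  All≢⇒∉ (_ ∷ x≢ys) (there x∈)  = All≢⇒∉ x≢ys x∈

  unique-⊆⇒≤ : ∀ {xs ys} → Unique xs → xs ⊆ ys → length xs ≤ length ys
  unique-⊆⇒≤ {[]}     u        sub = z≤n
  unique-⊆⇒≤ {x ∷ xs} {ys} (x∉ ∷ u) sub =
    ≤-trans (s≤s (unique-⊆⇒≤ u sub′)) (remove-shorter (sub (here refl)))
    where
    sub′ : xs ⊆ remove x ys
    sub′ y∈ = remove-keeps (sub (there y∈)) (λ { refl → All≢⇒∉ x∉ y∈ })

  unique-⊆-≥⇒⊇ : ∀ {xs ys} → Unique xs → xs ⊆ ys → length ys ≤ length xs → ys ⊆ xs
  unique-⊆-≥⇒⊇ {xs} {ys} u sub le {y} y∈ with y ∈? xs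
  ... | yes y∈xs = y∈xs
  ... | no  y∉xs = ⊥-elim (<-irrefl refl (≤-trans (remove-shorter y∈) (≤-trans le (unique-⊆⇒≤ u sub′))))
    where
    sub′ : xs ⊆ remove y ys
    sub′ z∈ = remove-keeps (sub z∈) (λ { refl → y∉xs z∈ })

  ⊇-unique-≤⇒unique : ∀ {xs ys} → Unique ys → ys ⊆ xs → length xs ≤ length ys → Unique xs
  ⊇-unique-≤⇒unique {[]}     u sub le = []
  ⊇-unique-≤⇒unique {x ∷ xs} {ys} u sub le with x ∈? xs
  ... | yes x∈xs = ⊥-elim (<-irrefl refl (≤-trans le (unique-⊆⇒≤ u sub′)))
    where
    sub′ : ys ⊆ xs
    sub′ y∈ with sub y∈
    ... | here refl = x∈xs
    ... | there y∈xs = y∈xs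
  ... | no x∉xs = ∉⇒All≢ x∉xs ∷ ⊇-unique-≤⇒unique (filter⁺ _ u) sub′ (≤-pred (≤-trans le (remove-length u)))
    where
    sub′ : remove x ys ⊆ xs
    sub′ y∈ with ∈-filter⁻ _ {xs = ys} y∈
    ... | y∈ys , x≢y with sub y∈ys
    ...   | here refl  = ⊥-elim (x≢y refl)
    ...   | there y∈xs = y∈xs

  map-unique : ∀ {Y : Set} (f : X → Y) {xs} → Unique xs →
               (∀ {a b} → a ∈ xs → b ∈ xs → f a ≡ f b → a ≡ b) → Unique (map f xs)
  map-unique f []              inj = []
  map-unique f {x ∷ xs} (x∉ ∷ u) inj = head x∉ (λ z∈ → z∈) ∷ map-unique f u (λ a b → inj (there a) (there b))
    where
    head : ∀ {zs} → All (x ≢_) zs → zs ⊆ xs → All (f x ≢_) (map f zs)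
    head []          _   = []
    head (x≢z ∷ x≢zs) sub =
      (λ e → x≢z (inj (here refl) (there (sub (here refl))) e)) ∷ head x≢zs (λ z∈ → sub (there z∈))

  count-≤-along : ∀ {P : List X} (Φ : X → X) (r s : X → Bool) → Unique P →
    (∀ {x} → x ∈ P → Φ (Φ x) ≡ x) →
    (∀ {x} → x ∈ P → r x ≡ true → Φ x ∈ P × s (Φ x) ≡ true) →
    countᵇ r P ≤ countᵇ s P
  count-≤-along {P} Φ r s u inv h =
    subst (_≤ countᵇ s P) (length-map Φ (filterᵇ r P)) (unique-⊆⇒≤ (map-unique Φ (filter⁺ _ u) inj) sub)
    where
    inj : ∀ {a b} → a ∈ filterᵇ r P → b ∈ filterᵇ r P → Φ a ≡ Φ b → a ≡ b
    inj a∈ b∈ e = trans (sym (inv (proj₁ (∈-filterᵇ⁻ r P a∈))))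
                        (trans (cong Φ e) (inv (proj₁ (∈-filterᵇ⁻ r P b∈))))
    sub : map Φ (filterᵇ r P) ⊆ filterᵇ s P
    sub y∈ with ∈-map⁻ Φ y∈
    ... | x , x∈ , refl = let x∈P , rx = ∈-filterᵇ⁻ r P x∈ ; Φx∈ , sΦx = h x∈P rx in ∈-filterᵇ⁺ s Φx∈ sΦx

  count-involution : ∀ {P : List X} (Φ : X → X) (q : X → Bool) → Unique P →
    (∀ {x} → x ∈ P → Φ x ∈ P) → (∀ {x} → x ∈ P → Φ (Φ x) ≡ x) →
    countᵇ q P ≡ countᵇ (λ x → q (Φ x)) P
  count-involution Φ q u closed inv = ≤-antisym
    (count-≤-along Φ q (λ x → q (Φ x)) u inv (λ x∈ qx → closed x∈ , trans (cong q (inv x∈)) qx))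
    (count-≤-along Φ (λ x → q (Φ x)) q u inv (λ x∈ qΦx → closed x∈ , qΦx))

range : ℕ → List ℕ
range n = applyUpTo suc n

range⁺ : ∀ {i n} → i < n → suc i ∈ range n
range⁺ = ∈-applyUpTo⁺ suc

range⁻ : ∀ {x n} → x ∈ range n → ∃ λ i → i < n × x ≡ suc i
range⁻ = ∈-applyUpTo⁻ suc

range-unique : ∀ n → Unique (range n)
range-unique n = applyUpTo⁺₁ suc n (λ i<j _ e → <-irrefl (suc-injective e) i<j)

words⁺ : ∀ n w → w ⊆ range n → w ∈ words n (length w)
words⁺ n []      sub = here refl
words⁺ n (x ∷ w) sub =
  ∈-concat⁺′ (∈-map⁺ (_∷ w) (sub (here refl)))
             (∈-map⁺ (λ v → map (_∷ v) (range n)) (words⁺ n w (λ y∈ → sub (there y∈))))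

words⁻ : ∀ n k w → w ∈ words n k → length w ≡ k × w ⊆ range n
words⁻ n zero    w (here refl) = refl , λ ()
words⁻ n (suc k) w w∈ with ∈-concat⁻′ (map (λ v → map (_∷ v) (range n)) (words n k)) w∈
... | ws , w∈ws , ws∈ with ∈-map⁻ (λ v → map (_∷ v) (range n)) ws∈
... | v , v∈ , refl with ∈-map⁻ (_∷ v) w∈ws
... | x , x∈ , refl = let len , sub = words⁻ n k v v∈ in
  cong suc len , λ { (here refl) → x∈ ; (there y∈) → sub y∈ }

words-unique : ∀ n k → Unique (words n k)
words-unique n zero    = [] ∷ []
words-unique n (suc k) =
  concat⁺ (All.map⁺ (All.universal extend-unique (words n k)))
          (AllPairs.map⁺ (AllPairs.map disjoint (words-unique n k)))
  where
  extend-unique : ∀ v → Unique (map (_∷ v) (range n))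
  extend-unique v = map⁺ ∷-injectiveˡ (range-unique n)
  disjoint : ∀ {v v′} → v ≢ v′ → ∀ {w} → ¬ (w ∈ map (_∷ v) (range n) × w ∈ map (_∷ v′) (range n))
  disjoint v≢v′ (w∈ , w∈′) with ∈-map⁻ _ w∈ | ∈-map⁻ _ w∈′
  ... | _ , _ , refl | _ , _ , e = v≢v′ (∷-injectiveʳ e)

memᵇ⁻ : ∀ x π → memᵇ x π ≡ true → x ∈ π
memᵇ⁻ x π e with any-true⁻ (x ≡ᵇ_) π e
... | y , y∈ , x≡ᵇy rewrite ≡ᵇ⇒≡ x y (Equivalence.from T-≡ x≡ᵇy) = y∈

memᵇ⁺ : ∀ x π → x ∈ π → memᵇ x π ≡ true
memᵇ⁺ x π x∈ = any-true⁺ (x ≡ᵇ_) x∈ (Equivalence.to T-≡ (≡⇒≡ᵇ x x refl))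

record IsPerm (n : ℕ) (π : List ℕ) : Set where
  constructor isPerm
  field
    length≡ : length π ≡ n
    ⊆range  : π ⊆ range n
    ⊇range  : range n ⊆ π

Sym⁺ : ∀ {n π} → IsPerm n π → π ∈ Sym n
Sym⁺ {n} {π} (isPerm len sub sup) =
  ∈-filterᵇ⁺ (isPermᵇ n) (subst (λ k → π ∈ words n k) len (words⁺ n π sub))
             (all-true⁺ (λ j → memᵇ j π) (range n) (λ {j} j∈ → memᵇ⁺ j π (sup j∈)))

Sym⁻ : ∀ {n π} → π ∈ Sym n → IsPerm n π
Sym⁻ {n} {π} π∈ with ∈-filterᵇ⁻ (isPermᵇ n) (words n n) π∈
... | π∈words , perm = let len , sub = words⁻ n n π π∈words in
  isPerm len sub (λ {j} j∈ → memᵇ⁻ j π (all-true⁻ (λ j → memᵇ j π) perm j∈))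

Sym-unique : ∀ n → Unique (Sym n)
Sym-unique n = filter⁺ _ (words-unique n n)

-- A permutation has no repeated entries (it covers range n with n entries).
perm-unique : ∀ {n π} → IsPerm n π → Unique π
perm-unique {n} (isPerm len sub sup) =
  Pigeonhole.⊇-unique-≤⇒unique _≟_ (range-unique n) sup (≤-reflexive (trans len (sym (length-applyUpTo suc n))))

-- |Sym n| = n!.  Every permutation of [1..n+1] arises exactly once by inserting
-- n+1 into a permutation of [1..n] at one of n+1 positions.

insertAt : ℕ → ℕ → List ℕ → List ℕ
insertAt x zero    π       = x ∷ π
insertAt x (suc k) []      = x ∷ []
insertAt x (suc k) (y ∷ π) = y ∷ insertAt x k π

insertAt-split : ∀ x k π → k ≤ length π →
  ∃₂ λ as bs → π ≡ as ++ bs × length as ≡ k × insertAt x k π ≡ as ++ x ∷ bs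
insertAt-split x zero    π       _         = [] , π , refl , refl , refl
insertAt-split x (suc k) (y ∷ π) (s≤s k≤) with insertAt-split x k π k≤
... | as , bs , refl , refl , e = y ∷ as , bs , refl , refl , cong (y ∷_) e

insertAt-++ : ∀ x as bs → insertAt x (length as) (as ++ bs) ≡ as ++ x ∷ bs
insertAt-++ x []       bs = refl
insertAt-++ x (a ∷ as) bs = cong (a ∷_) (insertAt-++ x as bs)

∈-middle⁻ : ∀ {v x : ℕ} as bs → v ∈ as ++ x ∷ bs → v ≡ x ⊎ v ∈ as ++ bs
∈-middle⁻ []       bs (here e)   = inj₁ e
∈-middle⁻ []       bs (there v∈) = inj₂ v∈
∈-middle⁻ (a ∷ as) bs (here e)   = inj₂ (here e)
∈-middle⁻ (a ∷ as) bs (there v∈) = Sum.map₂ there (∈-middle⁻ as bs v∈)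

∈-middle⁺ : ∀ {v x : ℕ} as bs → v ∈ as ++ bs → v ∈ as ++ x ∷ bs
∈-middle⁺ []       bs v∈         = there v∈
∈-middle⁺ (a ∷ as) bs (here e)   = here e
∈-middle⁺ (a ∷ as) bs (there v∈) = there (∈-middle⁺ as bs v∈)

∈-middle : ∀ {x : ℕ} as bs → x ∈ as ++ x ∷ bs
∈-middle []       bs = here refl
∈-middle (a ∷ as) bs = there (∈-middle as bs)

middle-injective : ∀ {x : ℕ} as bs as′ bs′ → as ++ x ∷ bs ≡ as′ ++ x ∷ bs′ → x ∉ as → x ∉ as′ →
                   as ≡ as′ × bs ≡ bs′
middle-injective []       bs []         bs′ e _  _   = refl , ∷-injectiveʳ e
middle-injective []       bs (a′ ∷ as′) bs′ e _  x∉′ = ⊥-elim (x∉′ (here (∷-injectiveˡ e)))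
middle-injective (a ∷ as) bs []         bs′ e x∉ _   = ⊥-elim (x∉ (here (sym (∷-injectiveˡ e))))
middle-injective (a ∷ as) bs (a′ ∷ as′) bs′ e x∉ x∉′
  with refl ← ∷-injectiveˡ e
  with refl , refl ← middle-injective as bs as′ bs′ (∷-injectiveʳ e) (x∉ ∘ there) (x∉′ ∘ there)
  = refl , refl

unique-middle : ∀ {x : ℕ} as bs → Unique (as ++ x ∷ bs) → x ∉ as × x ∉ bs
unique-middle []       bs (x∉bs ∷ _) = (λ ()) , Pigeonhole.All≢⇒∉ _≟_ x∉bs
unique-middle (a ∷ as) bs (a∉ ∷ u)   =
  (λ { (here refl) → All.lookup a∉ (∈-middle as bs) refl ; (there x∈) → proj₁ (unique-middle as bs u) x∈ })
  , proj₂ (unique-middle as bs u)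

suc-∉range : ∀ n → suc n ∉ range n
suc-∉range n sn∈ with range⁻ sn∈
... | i , i<n , e = <-irrefl (suc-injective (sym e)) i<n

range-suc⁻ : ∀ {n v} → v ∈ range (suc n) → v ≡ suc n ⊎ v ∈ range n
range-suc⁻ v∈ with range⁻ v∈
... | i , i<sn , refl with m≤n⇒m<n∨m≡n (≤-pred i<sn)
... | inj₁ i<n  = inj₂ (range⁺ i<n)
... | inj₂ refl = inj₁ refl

range-suc⁺ : ∀ {n v} → v ∈ range n → v ∈ range (suc n)
range-suc⁺ v∈ with range⁻ v∈
... | i , i<n , refl = range⁺ (m<n⇒m<1+n i<n)

insertTop : ℕ → ℕ × List ℕ → List ℕ
insertTop n (k , π) = insertAt (suc n) k π

extensions : ℕ → List (List ℕ)
extensions n = map (insertTop n) (cartesianProduct (upTo (suc n)) (Sym n))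

extension-split : ∀ {n k π} → (k , π) ∈ cartesianProduct (upTo (suc n)) (Sym n) →
  ∃₂ λ as bs → π ≡ as ++ bs × length as ≡ k × insertAt (suc n) k π ≡ as ++ suc n ∷ bs
             × suc n ∉ as × IsPerm n π
extension-split {n} {k} {π} kπ∈ with ∈-cartesianProduct⁻ (upTo (suc n)) (Sym n) kπ∈
... | k∈ , π∈ with Sym⁻ π∈
... | perm@(isPerm len sub sup) with insertAt-split (suc n) k π (subst (k ≤_) (sym len) (≤-pred (∈-upTo⁻ k∈)))
... | as , bs , refl , e₁ , e₂ =
  as , bs , refl , e₁ , e₂ , (λ sn∈ → suc-∉range n (sub (∈-++⁺ˡ sn∈))) , perm

extensions-length : ∀ n → length (extensions n) ≡ suc n * length (Sym n)
extensions-length n = begin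
  length (extensions n)
    ≡⟨ length-map _ pairs ⟩
  length pairs
    ≡⟨ count-true pairs ⟨
  countᵇ (λ ab → true ∧ true) pairs
    ≡⟨ count-product (λ _ → true) (λ _ → true) (upTo (suc n)) (Sym n) ⟩
  countᵇ (λ _ → true) (upTo (suc n)) * countᵇ (λ _ → true) (Sym n)
    ≡⟨ cong₂ _*_ (trans (count-true (upTo (suc n))) (length-upTo (suc n))) (count-true (Sym n)) ⟩
  suc n * length (Sym n) ∎
  where
  open ≡-Reasoning
  pairs = cartesianProduct (upTo (suc n)) (Sym n)

extensions⊆Sym : ∀ n → extensions n ⊆ Sym (suc n)
extensions⊆Sym n ρ∈ with ∈-map⁻ _ ρ∈
... | (k , π) , kπ∈ , refl with extension-split kπ∈
... | as , bs , refl , _ , e , _ , isPerm len sub sup = subst (_∈ Sym (suc n)) (sym e) (Sym⁺ (isPerm len′ sub′ sup′))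
  where
  len′ : length (as ++ suc n ∷ bs) ≡ suc n
  len′ = trans (length-++-sucʳ as (suc n) bs) (cong suc len)
  sub′ : (as ++ suc n ∷ bs) ⊆ range (suc n)
  sub′ v∈ = [ (λ { refl → range⁺ (n<1+n n) }) , (λ v∈′ → range-suc⁺ (sub v∈′)) ]′ (∈-middle⁻ as bs v∈)
  sup′ : range (suc n) ⊆ (as ++ suc n ∷ bs)
  sup′ v∈ = [ (λ { refl → ∈-middle as bs }) , (λ v∈′ → ∈-middle⁺ as bs (sup v∈′)) ]′ (range-suc⁻ v∈)

Sym⊆extensions : ∀ n → Sym (suc n) ⊆ extensions n
Sym⊆extensions n ρ∈ with Sym⁻ ρ∈
... | perm@(isPerm len sub sup) with ∈-∃++ (sup (range⁺ (n<1+n n)))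
... | as , bs , refl =
  subst (_∈ extensions n) (insertAt-++ (suc n) as bs)
        (∈-map⁺ _ (∈-cartesianProduct⁺ (∈-upTo⁺ (s≤s as≤n)) (Sym⁺ (isPerm len′ sub′ sup′))))
  where
  sn∉ = unique-middle as bs (perm-unique perm)
  len′ : length (as ++ bs) ≡ n
  len′ = suc-injective (trans (sym (length-++-sucʳ as (suc n) bs)) len)
  as≤n : length as ≤ n
  as≤n = subst (length as ≤_) len′ (length-++-≤ˡ as)
  sub′ : (as ++ bs) ⊆ range n
  sub′ v∈ = [ (λ { refl → ⊥-elim ([ proj₁ sn∉ , proj₂ sn∉ ]′ (∈-++⁻ as v∈)) }) , id ]′
              (range-suc⁻ (sub (∈-middle⁺ as bs v∈)))
  sup′ : range n ⊆ (as ++ bs)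
  sup′ v∈ = [ (λ { refl → ⊥-elim (suc-∉range n v∈) }) , id ]′ (∈-middle⁻ as bs (sup (range-suc⁺ v∈)))

extensions-unique : ∀ n → Unique (extensions n)
extensions-unique n =
  Pigeonhole.map-unique (×-≡-dec _≟_ (≡-dec _≟_)) _ (cartesianProduct⁺ (upTo⁺ (suc n)) (Sym-unique n)) inj
  where
  inj : ∀ {a b} → a ∈ cartesianProduct (upTo (suc n)) (Sym n) → b ∈ cartesianProduct (upTo (suc n)) (Sym n) →
        insertTop n a ≡ insertTop n b → a ≡ b
  inj a∈ b∈ e with extension-split a∈ | extension-split b∈
  ... | as , bs , refl , refl , ea , sn∉ , _ | as′ , bs′ , refl , refl , eb , sn∉′ , _
    with refl , refl ← middle-injective as bs as′ bs′ (trans (sym ea) (trans e eb)) sn∉ sn∉′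
    = refl

|Sym|≡! : ∀ n → length (Sym n) ≡ n !
|Sym|≡! zero    = refl
|Sym|≡! (suc n) = begin
  length (Sym (suc n))    ≡⟨ ≤-antisym (unique-⊆⇒≤ (Sym-unique (suc n)) (Sym⊆extensions n))
                                       (unique-⊆⇒≤ (extensions-unique n) (extensions⊆Sym n)) ⟩
  length (extensions n)   ≡⟨ extensions-length n ⟩
  suc n * length (Sym n)  ≡⟨ cong (suc n *_) (|Sym|≡! n) ⟩
  suc n !                 ∎
  where
  open ≡-Reasoning
  open Pigeonhole (≡-dec _≟_) using (unique-⊆⇒≤)

-- Positional access.  at xs p is the entry of xs at (0-based) position p, and 0
-- past the end; it lets windows take m (drop i π) be read position by position.

at : List ℕ → ℕ → ℕ
at []       _       = 0
at (x ∷ xs) zero    = x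
at (x ∷ xs) (suc p) = at xs p

at-beyond : ∀ xs p → length xs ≤ p → at xs p ≡ 0
at-beyond []       p       _        = refl
at-beyond (x ∷ xs) (suc p) (s≤s le) = at-beyond xs p le

at-∈ : ∀ xs p → p < length xs → at xs p ∈ xs
at-∈ (x ∷ xs) zero    _        = here refl
at-∈ (x ∷ xs) (suc p) (s≤s lt) = there (at-∈ xs p lt)

∈⇒at : ∀ {v} xs → v ∈ xs → ∃ λ p → p < length xs × at xs p ≡ v
∈⇒at (x ∷ xs) (here refl) = 0 , s≤s z≤n , refl
∈⇒at (x ∷ xs) (there v∈)  = let p , lt , e = ∈⇒at xs v∈ in suc p , s≤s lt , e

at-injective : ∀ xs {p q} → Unique xs → p < length xs → q < length xs → at xs p ≡ at xs q → p ≡ q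
at-injective (x ∷ xs) {zero}  {zero}  u         _        _        _ = refl
at-injective (x ∷ xs) {zero}  {suc q} (x∉ ∷ u) _        (s≤s lq) e = ⊥-elim (All.lookup x∉ (at-∈ xs q lq) e)
at-injective (x ∷ xs) {suc p} {zero}  (x∉ ∷ u) (s≤s lp) _        e = ⊥-elim (All.lookup x∉ (at-∈ xs p lp) (sym e))
at-injective (x ∷ xs) {suc p} {suc q} (_ ∷ u)  (s≤s lp) (s≤s lq) e = cong suc (at-injective xs u lp lq e)

at-applyUpTo : ∀ f n p → p < n → at (applyUpTo f n) p ≡ f p
at-applyUpTo f (suc n) zero    _        = refl
at-applyUpTo f (suc n) (suc p) (s≤s lt) = at-applyUpTo (f ∘ suc) n p lt

applyUpTo-at : ∀ xs → applyUpTo (at xs) (length xs) ≡ xs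
applyUpTo-at []       = refl
applyUpTo-at (x ∷ xs) = cong (x ∷_) (applyUpTo-at xs)

at-map : ∀ f xs p → p < length xs → at (map f xs) p ≡ f (at xs p)
at-map f (x ∷ xs) zero    _        = refl
at-map f (x ∷ xs) (suc p) (s≤s lt) = at-map f xs p lt

at-ext : ∀ xs ys → length xs ≡ length ys → (∀ p → p < length xs → at xs p ≡ at ys p) → xs ≡ ys
at-ext []       []       _ _ = refl
at-ext (x ∷ xs) (y ∷ ys) e h =
  cong₂ _∷_ (h 0 (s≤s z≤n)) (at-ext xs ys (suc-injective e) (λ p lt → h (suc p) (s≤s lt)))

count-positions : ∀ (p : ℕ → Bool) xs → countᵇ p xs ≡ countᵇ (λ b → p (at xs b)) (upTo (length xs))
count-positions p xs = begin
  countᵇ p xs                                    ≡⟨ cong (countᵇ p) (applyUpTo-at xs) ⟨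
  countᵇ p (applyUpTo (at xs) (length xs))       ≡⟨ cong (countᵇ p) (map-upTo (at xs) (length xs)) ⟨
  countᵇ p (map (at xs) (upTo (length xs)))      ≡⟨ count-map p (at xs) (upTo (length xs)) ⟩
  countᵇ (λ b → p (at xs b)) (upTo (length xs))  ∎
  where open ≡-Reasoning

<∸⇒+< : ∀ i a l → a < l ∸ i → i + a < l
<∸⇒+< zero    a l       lt = lt
<∸⇒+< (suc i) a (suc l) lt = s≤s (<∸⇒+< i a l lt)

window-length : ∀ (xs : List ℕ) m i → length (take m (drop i xs)) ≡ m ⊓ (length xs ∸ i)
window-length xs m i = trans (length-take m (drop i xs)) (cong (m ⊓_) (length-drop i xs))

at-window : ∀ xs m i a → a < m → at (take m (drop i xs)) a ≡ at xs (i + a)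
at-window xs m i a a<m = trans (at-take (drop i xs) m a a<m) (at-drop xs i a)
  where
  at-drop : ∀ xs i a → at (drop i xs) a ≡ at xs (i + a)
  at-drop xs       zero    a = refl
  at-drop []       (suc i) a = refl
  at-drop (x ∷ xs) (suc i) a = at-drop xs i a
  at-take : ∀ xs m a → a < m → at (take m xs) a ≡ at xs a
  at-take []       zero    a       _        = refl
  at-take []       (suc m) a       _        = refl
  at-take (x ∷ xs) (suc m) zero    _        = refl
  at-take (x ∷ xs) (suc m) (suc a) (s≤s lt) = at-take xs m a lt

window-bound : ∀ xs m i a → a < length (take m (drop i xs)) → a < m × i + a < length xs
window-bound xs m i a lt = ≤-trans lt′ (m⊓n≤m m _) , <∸⇒+< i a (length xs) (≤-trans lt′ (m⊓n≤n m _))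
  where
  lt′ : a < m ⊓ (length xs ∸ i)
  lt′ = subst (a <_) (window-length xs m i) lt

window-cong : ∀ xs ys m i → length xs ≡ length ys → (∀ a → a < m → at xs (i + a) ≡ at ys (i + a)) →
              take m (drop i xs) ≡ take m (drop i ys)
window-cong xs ys m i len h = at-ext _ _ len′ pointwise
  where
  len′ = trans (window-length xs m i) (trans (cong (λ k → m ⊓ (k ∸ i)) len) (sym (window-length ys m i)))
  pointwise : ∀ a → a < length (take m (drop i xs)) → at (take m (drop i xs)) a ≡ at (take m (drop i ys)) a
  pointwise a lt = let a<m = proj₁ (window-bound xs m i a lt) in
    trans (at-window xs m i a a<m) (trans (h a a<m) (sym (at-window ys m i a a<m)))

SameOrder : List ℕ → List ℕ → Set
SameOrder xs ys = length xs ≡ length ys ×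
  (∀ a b → a < length xs → b < length xs → (at xs a <ᵇ at xs b) ≡ (at ys a <ᵇ at ys b))

st-cong : ∀ xs ys → SameOrder xs ys → st xs ≡ st ys
st-cong xs ys (len , same) = at-ext (st xs) (st ys) len′ pointwise
  where
  rank+1 : List ℕ → ℕ → ℕ
  rank+1 zs x = suc (countᵇ (λ y → y <ᵇ x) zs)
  len′ = trans (length-map (rank+1 xs) xs) (trans len (sym (length-map (rank+1 ys) ys)))
  smaller : ∀ p → p < length xs → countᵇ (λ y → y <ᵇ at xs p) xs ≡ countᵇ (λ y → y <ᵇ at ys p) ys
  smaller p lt = begin
    countᵇ (λ y → y <ᵇ at xs p) xs                           ≡⟨ count-positions _ xs ⟩
    countᵇ (λ b → at xs b <ᵇ at xs p) (upTo (length xs))     ≡⟨ count-cong _ _ (λ b∈ → same _ p (∈-upTo⁻ b∈) lt) ⟩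
    countᵇ (λ b → at ys b <ᵇ at ys p) (upTo (length xs))     ≡⟨ cong (countᵇ _ ∘ upTo) len ⟩
    countᵇ (λ b → at ys b <ᵇ at ys p) (upTo (length ys))     ≡⟨ count-positions _ ys ⟨
    countᵇ (λ y → y <ᵇ at ys p) ys                           ∎
    where open ≡-Reasoning
  pointwise : ∀ p → p < length (st xs) → at (st xs) p ≡ at (st ys) p
  pointwise p lt₀ = trans (at-map (rank+1 xs) xs p lt) (trans (cong suc (smaller p lt))
                          (sym (at-map (rank+1 ys) ys p (subst (p <_) len lt))))
    where lt = subst (p <_) (length-map (rank+1 xs) xs) lt₀

<⇒<ᵇ≡true : ∀ {m n} → m < n → (m <ᵇ n) ≡ true
<⇒<ᵇ≡true lt = Equivalence.to T-≡ (<⇒<ᵇ lt)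

<ᵇ≡true⇒< : ∀ {m n} → (m <ᵇ n) ≡ true → m < n
<ᵇ≡true⇒< {m} {n} e = <ᵇ⇒< m n (Equivalence.from T-≡ e)

≥⇒<ᵇ≡false : ∀ {m n} → n ≤ m → (m <ᵇ n) ≡ false
≥⇒<ᵇ≡false {m}     {zero}  _         = refl
≥⇒<ᵇ≡false {suc m} {suc n} (s≤s n≤m) = ≥⇒<ᵇ≡false n≤m

rank : ℕ → List ℕ → ℕ
rank x l = countᵇ (_<ᵇ x) l

rank-mono : ∀ {x y} l → x ≤ y → rank x l ≤ rank y l
rank-mono l x≤y = count-mono _ _ l (λ z z<x → <⇒<ᵇ≡true (<-≤-trans (<ᵇ≡true⇒< z<x) x≤y))

rank-strict : ∀ {x y} l → x < y → x ∈ l → rank x l < rank y l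
rank-strict {x} l x<y x∈ =
  count-strict _ _ l x∈ (≥⇒<ᵇ≡false {x} ≤-refl) (<⇒<ᵇ≡true x<y)
               (λ z z<x → <⇒<ᵇ≡true (<-trans (<ᵇ≡true⇒< z<x) x<y))

rank-order : ∀ {x} y l → x ∈ l → (x <ᵇ y) ≡ (rank x l <ᵇ rank y l)
rank-order {x} y l x∈ with <-≤-connex x y
... | inj₁ x<y = trans (<⇒<ᵇ≡true x<y) (sym (<⇒<ᵇ≡true (rank-strict l x<y x∈)))
... | inj₂ y≤x = trans (≥⇒<ᵇ≡false y≤x) (sym (≥⇒<ᵇ≡false (rank-mono l y≤x)))

rank-injective : ∀ {x y} l → x ∈ l → y ∈ l → rank x l ≡ rank y l → x ≡ y
rank-injective {x} {y} l x∈ y∈ e with <-cmp x y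
... | tri< x<y _ _ = ⊥-elim (<-irrefl e (rank-strict l x<y x∈))
... | tri≈ _ x≡y _ = x≡y
... | tri> _ _ y<x = ⊥-elim (<-irrefl (sym e) (rank-strict l y<x y∈))

rank-bound : ∀ {x} l → x ∈ l → rank x l < length l
rank-bound {x} l x∈ = subst (rank x l <_) (count-true l)
  (count-strict (_<ᵇ x) (λ _ → true) l x∈ (≥⇒<ᵇ≡false {x} ≤-refl) refl (λ _ _ → refl))

-- Every rank below the length is attained (pigeonhole on the injective rank map).
rank-surjective : ∀ l {r} → Unique l → r < length l → ∃ λ x → x ∈ l × rank x l ≡ r
rank-surjective l {r} u r<
  with ∈-map⁻ (λ x → rank x l) (unique-⊆-≥⇒⊇ ranks-unique ranks-bounded ranks-long (∈-upTo⁺ r<))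
  where
  open Pigeonhole _≟_ using (unique-⊆-≥⇒⊇; map-unique)
  ranks-unique : Unique (map (λ x → rank x l) l)
  ranks-unique = map-unique (λ x → rank x l) u (λ x∈ y∈ → rank-injective l x∈ y∈)
  ranks-bounded : map (λ x → rank x l) l ⊆ upTo (length l)
  ranks-bounded r∈ with ∈-map⁻ (λ x → rank x l) r∈
  ... | x , x∈ , refl = ∈-upTo⁺ (rank-bound l x∈)
  ranks-long : length (upTo (length l)) ≤ length (map (λ x → rank x l) l)
  ranks-long = ≤-reflexive (trans (length-upTo (length l)) (sym (length-map _ l)))
... | x , x∈ , e = x , x∈ , sym e

-- The first element of a list passing a test (0 if there is none).
at-filter-first : ∀ (p : ℕ → Bool) l {x} → x ∈ l → p x ≡ true →
                  at (filterᵇ p l) 0 ∈ l × p (at (filterᵇ p l) 0) ≡ true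
at-filter-first p (y ∷ l) (here refl) px rewrite px = here refl , px
at-filter-first p (y ∷ l) (there x∈)  px with p y in py
... | true  = here refl , py
... | false = Product.map₁ there (at-filter-first p l x∈ px)

select : List ℕ → ℕ → ℕ
select l r = at (filterᵇ (λ x → rank x l ≡ᵇ r) l) 0

select-spec : ∀ l {r} → Unique l → r < length l → select l r ∈ l × rank (select l r) l ≡ r
select-spec l {r} u r< with rank-surjective l u r<
... | x , x∈ , refl
  with at-filter-first (λ y → rank y l ≡ᵇ rank x l) l x∈ (Equivalence.to T-≡ (≡⇒≡ᵇ (rank x l) _ refl))
... | s∈ , e = s∈ , ≡ᵇ⇒≡ _ _ (Equivalence.from T-≡ e)

-- Fix n and a set V of marked positions.  For permutations π, ρ of
-- [1..n], graft π ρ agrees with π at unmarked positions, while at the marked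
-- positions it carries the values π has there, rearranged into the relative
-- order that ρ has there.
module Graft (n : ℕ) (V : ℕ → Bool) where

  marked : List ℕ
  marked = filterᵇ V (upTo n)

  marked⁺ : ∀ {p} → p < n → V p ≡ true → p ∈ marked
  marked⁺ p<n Vp = ∈-filterᵇ⁺ V (∈-upTo⁺ p<n) Vp

  marked⁻ : ∀ {p} → p ∈ marked → p < n × V p ≡ true
  marked⁻ p∈ = Product.map₁ ∈-upTo⁻ (∈-filterᵇ⁻ V (upTo n) p∈)

  values : List ℕ → List ℕ
  values π = map (at π) marked

  values-length : ∀ π → length (values π) ≡ length marked
  values-length π = length-map (at π) marked

  values-unique : ∀ {π} → IsPerm n π → Unique (values π)
  values-unique {π} perm@(isPerm len _ _) =
    Pigeonhole.map-unique _≟_ (at π) (filter⁺ _ (upTo⁺ n)) λ p∈ q∈ →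
      at-injective π (perm-unique perm) (bound p∈) (bound q∈)
    where
    bound : ∀ {p} → p ∈ marked → p < length π
    bound p∈ = subst (_ <_) (sym len) (proj₁ (marked⁻ p∈))

  ∈-values : ∀ π {p} → p ∈ marked → at π p ∈ values π
  ∈-values π p∈ = ∈-map⁺ (at π) p∈

  values⊆ : ∀ {π} → IsPerm n π → values π ⊆ π
  values⊆ {π} (isPerm len _ _) v∈ with ∈-map⁻ (at π) v∈
  ... | p , p∈ , refl = at-∈ π p (subst (p <_) (sym len) (proj₁ (marked⁻ p∈)))

  -- The rank of the value at marked position p among all marked values: it only
  -- depends on the relative order of π on the marked positions.
  markedRank : List ℕ → ℕ → ℕ
  markedRank π p = rank (at π p) (values π)

  markedRank-bound : ∀ π {p} → p ∈ marked → markedRank π p < length marked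
  markedRank-bound π {p} p∈ = subst (markedRank π p <_) (values-length π) (rank-bound (values π) (∈-values π p∈))

  markedRank-cong : ∀ π ρ p → (∀ {q} → q ∈ marked → (at π q <ᵇ at π p) ≡ (at ρ q <ᵇ at ρ p)) →
                    markedRank π p ≡ markedRank ρ p
  markedRank-cong π ρ p same = begin
    rank (at π p) (values π)                ≡⟨ count-map (_<ᵇ at π p) (at π) marked ⟩
    countᵇ (λ q → at π q <ᵇ at π p) marked  ≡⟨ count-cong _ (λ q → at ρ q <ᵇ at ρ p) same ⟩
    countᵇ (λ q → at ρ q <ᵇ at ρ p) marked  ≡⟨ count-map (_<ᵇ at ρ p) (at ρ) marked ⟨
    rank (at ρ p) (values ρ)                ∎
    where open ≡-Reasoning

  graftAt : List ℕ → List ℕ → ℕ → ℕ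
  graftAt π ρ p = if V p then select (values π) (markedRank ρ p) else at π p

  graft : List ℕ → List ℕ → List ℕ
  graft π ρ = applyUpTo (graftAt π ρ) n

  graft-length : ∀ π ρ → length (graft π ρ) ≡ n
  graft-length π ρ = length-applyUpTo (graftAt π ρ) n

  graft-unmarked : ∀ π ρ p → length π ≡ n → V p ≡ false → at (graft π ρ) p ≡ at π p
  graft-unmarked π ρ p len Vp with p <? n
  ... | yes p<n rewrite at-applyUpTo (graftAt π ρ) n p p<n | Vp = refl
  ... | no  p≮n = trans (at-beyond (graft π ρ) p (subst (_≤ p) (sym (graft-length π ρ)) (≮⇒≥ p≮n)))
                        (sym (at-beyond π p (subst (_≤ p) (sym len) (≮⇒≥ p≮n))))

  graft-marked : ∀ {π ρ p} → IsPerm n π → p ∈ marked →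
                 at (graft π ρ) p ∈ values π × rank (at (graft π ρ) p) (values π) ≡ markedRank ρ p
  graft-marked {π} {ρ} {p} perm p∈ with marked⁻ p∈
  ... | p<n , Vp rewrite at-applyUpTo (graftAt π ρ) n p p<n | Vp =
    select-spec (values π) (values-unique perm)
                (subst (_ <_) (sym (values-length π)) (markedRank-bound ρ p∈))

  graft-order : ∀ {π ρ p q} → IsPerm n π → p ∈ marked → q ∈ marked →
                (at (graft π ρ) p <ᵇ at (graft π ρ) q) ≡ (at ρ p <ᵇ at ρ q)
  graft-order {π} {ρ} {p} {q} perm p∈ q∈ =
    let gp∈ , rank-gp = graft-marked {ρ = ρ} perm p∈ ; _ , rank-gq = graft-marked {ρ = ρ} perm q∈ in
    begin
      at (graft π ρ) p <ᵇ at (graft π ρ) q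
        ≡⟨ rank-order (at (graft π ρ) q) (values π) gp∈ ⟩
      rank (at (graft π ρ) p) (values π) <ᵇ rank (at (graft π ρ) q) (values π)
        ≡⟨ cong₂ _<ᵇ_ rank-gp rank-gq ⟩
      markedRank ρ p <ᵇ markedRank ρ q
        ≡⟨ rank-order (at ρ q) (values ρ) (∈-values ρ p∈) ⟨
      at ρ p <ᵇ at ρ q ∎
    where open ≡-Reasoning

  graft-markedRank : ∀ {π ρ p} → IsPerm n π → p ∈ marked → markedRank (graft π ρ) p ≡ markedRank ρ p
  graft-markedRank {π} {ρ} {p} perm p∈ =
    markedRank-cong (graft π ρ) ρ p (λ q∈ → graft-order {ρ = ρ} perm q∈ p∈)

  -- Every marked value of π occurs at the marked position of graft π ρ whose
  -- ρ-rank is its rank.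
  graft-hits : ∀ {π ρ p} → IsPerm n π → IsPerm n ρ → p ∈ marked → at π p ∈ graft π ρ
  graft-hits {π} {ρ} {p} permπ permρ p∈
    with rank-surjective (values ρ) (values-unique permρ)
           (subst (_ <_) (trans (values-length π) (sym (values-length ρ))) (rank-bound (values π) (∈-values π p∈)))
  ... | x , x∈ , rank-x with ∈-map⁻ (at ρ) x∈
  ... | q , q∈ , refl =
    let gq∈ , rank-gq = graft-marked {ρ = ρ} permπ q∈
        gq≡πp = rank-injective (values π) gq∈ (∈-values π p∈) (trans rank-gq rank-x)
    in subst (_∈ graft π ρ) gq≡πp
             (at-∈ (graft π ρ) q (subst (q <_) (sym (graft-length π ρ)) (proj₁ (marked⁻ q∈))))

  -- graft π ρ is a permutation: its entries come from π, and it hits every value.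
  graft-perm : ∀ {π ρ} → IsPerm n π → IsPerm n ρ → IsPerm n (graft π ρ)
  graft-perm {π} {ρ} permπ@(isPerm len sub sup) permρ = isPerm (graft-length π ρ) sub′ sup′
    where
    sub′ : graft π ρ ⊆ range n
    sub′ v∈ with ∈⇒at (graft π ρ) v∈
    ... | p , p< , refl with V p in Vp
    ... | true  = sub (values⊆ permπ (proj₁ (graft-marked {ρ = ρ} permπ (marked⁺ (subst (p <_) (graft-length π ρ) p<) Vp))))
    ... | false = subst (_∈ range n) (sym (graft-unmarked π ρ p len Vp))
                        (sub (at-∈ π p (subst (p <_) (trans (graft-length π ρ) (sym len)) p<)))
    sup′ : range n ⊆ graft π ρ
    sup′ j∈ with ∈⇒at π (sup j∈)
    ... | p , p< , refl with V p in Vp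
    ... | true  = graft-hits permπ permρ (marked⁺ (subst (p <_) len p<) Vp)
    ... | false = subst (_∈ graft π ρ) (graft-unmarked π ρ p len Vp)
                        (at-∈ (graft π ρ) p (subst (p <_) (trans len (sym (graft-length π ρ))) p<))

  graft-involutive : ∀ {π ρ} → IsPerm n π → IsPerm n ρ → graft (graft π ρ) (graft ρ π) ≡ π
  graft-involutive {π} {ρ} permπ@(isPerm len _ _) permρ =
    at-ext (graft π′ ρ′) π (trans (graft-length π′ ρ′) (sym len)) pointwise
    where
    π′ = graft π ρ
    ρ′ = graft ρ π
    permπ′ = graft-perm permπ permρ
    pointwise : ∀ p → p < length (graft π′ ρ′) → at (graft π′ ρ′) p ≡ at π p
    pointwise p p< with V p in Vp
    ... | false = trans (graft-unmarked π′ ρ′ p (graft-length π ρ) Vp) (graft-unmarked π ρ p len Vp)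
    ... | true with graft-marked {ρ = ρ′} permπ′ p∈
      where p∈ = marked⁺ (subst (p <_) (graft-length π′ ρ′) p<) Vp
    ... | u∈ , rank-u with ∈-map⁻ (at π′) u∈
    ... | q , q∈ , u≡π′q = rank-injective (values π) u∈values (∈-values π p∈) ranks
      where
      p∈ = marked⁺ (subst (p <_) (graft-length π′ ρ′) p<) Vp
      u = at (graft π′ ρ′) p
      u∈values : u ∈ values π
      u∈values = subst (_∈ values π) (sym u≡π′q) (proj₁ (graft-marked {ρ = ρ} permπ q∈))
      ranks : rank u (values π) ≡ markedRank π p
      ranks = begin
        rank u (values π)          ≡⟨ cong (λ w → rank w (values π)) u≡π′q ⟩
        rank (at π′ q) (values π)  ≡⟨ proj₂ (graft-marked {ρ = ρ} permπ q∈) ⟩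
        markedRank ρ q             ≡⟨ graft-markedRank {ρ = ρ} permπ q∈ ⟨
        markedRank π′ q            ≡⟨ cong (λ w → rank w (values π′)) u≡π′q ⟨
        rank u (values π′)         ≡⟨ rank-u ⟩
        markedRank ρ′ p            ≡⟨ graft-markedRank {ρ = π} permρ p∈ ⟩
        markedRank π p             ∎
        where open ≡-Reasoning

Ev-cong : ∀ m σ P N π π′ →
          (∀ {i} → i ∈ P → A m σ i π ≡ A m σ i π′) → (∀ {i} → i ∈ N → A m σ i π ≡ A m σ i π′) →
          Ev m σ P N π ≡ Ev m σ P N π′
Ev-cong m σ P N π π′ onP onN =
  cong₂ _∧_ (all-cong _ _ P onP) (all-cong _ _ N (λ i∈ → cong not (onN i∈)))

∣-∣<-window : ∀ i j m → i < j + m → j < i + m → ∣ i - j ∣ < m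
∣-∣<-window zero    j       m h₁        h₂        = h₂
∣-∣<-window (suc i) zero    m h₁        h₂        = h₁
∣-∣<-window (suc i) (suc j) m (s≤s h₁) (s≤s h₂) = ∣-∣<-window i j m h₁ h₂

-- Let the covered positions be those in some window
-- [j, j+m) with j ∈ T; by separation no window [i, i+m) with i ∈ S meets them.
-- Grafting on the covered positions keeps the S-events of π and takes the
-- T-events of ρ, which yields  #(E ∧ F) · n! = #E · #F.
module Separated (n m : ℕ) (σ : List ℕ) (S T : List ℕ) (separated : ∀ i j → i ∈ S → j ∈ T → m ≤ ∣ i - j ∣) where

  covered : ℕ → Bool
  covered p = any (λ j → (j ≤ᵇ p) ∧ (p <ᵇ j + m)) T

  open Graft n covered

  S-window-uncovered : ∀ {i a} → i ∈ S → a < m → covered (i + a) ≡ false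
  S-window-uncovered {i} {a} i∈ a<m = any-false _ T not-in-window
    where
    not-in-window : ∀ {j} → j ∈ T → ((j ≤ᵇ i + a) ∧ (i + a <ᵇ j + m)) ≡ false
    not-in-window {j} j∈ with (j ≤ᵇ i + a) in j≤ | (i + a <ᵇ j + m) in <j+m
    ... | false | _     = refl
    ... | true  | false = refl
    ... | true  | true  = ⊥-elim (<⇒≱ close (separated i j i∈ j∈))
      where
      close : ∣ i - j ∣ < m
      close = ∣-∣<-window i j m (≤-<-trans (m≤m+n i a) (<ᵇ≡true⇒< <j+m))
                                (≤-<-trans (≤ᵇ⇒≤ j (i + a) (Equivalence.from T-≡ j≤)) (+-monoʳ-< i a<m))

  T-window-covered : ∀ {j a} → j ∈ T → a < m → covered (j + a) ≡ true
  T-window-covered {j} {a} j∈ a<m = any-true⁺ (λ j′ → (j′ ≤ᵇ j + a) ∧ (j + a <ᵇ j′ + m)) j∈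
    (cong₂ _∧_ (Equivalence.to T-≡ (≤⇒≤ᵇ (m≤m+n j a))) (<⇒<ᵇ≡true (+-monoʳ-< j a<m)))

  A-graft-S : ∀ {i π} ρ → i ∈ S → IsPerm n π → A m σ i (graft π ρ) ≡ A m σ i π
  A-graft-S {i} {π} ρ i∈ (isPerm len _ _) = cong (λ w → st w ==ᴸ σ)
    (window-cong (graft π ρ) π m i (trans (graft-length π ρ) (sym len))
                 (λ a a<m → graft-unmarked π ρ (i + a) len (S-window-uncovered i∈ a<m)))

  A-graft-T : ∀ {j π ρ} → j ∈ T → IsPerm n π → IsPerm n ρ → A m σ j (graft π ρ) ≡ A m σ j ρ
  A-graft-T {j} {π} {ρ} j∈ permπ (isPerm lenρ _ _) = cong (_==ᴸ σ) (st-cong W Wρ (len , same))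
    where
    W  = take m (drop j (graft π ρ))
    Wρ = take m (drop j ρ)
    len : length W ≡ length Wρ
    len = trans (window-length (graft π ρ) m j)
                (trans (cong (λ k → m ⊓ (k ∸ j)) (trans (graft-length π ρ) (sym lenρ))) (sym (window-length ρ m j)))
    entry : ∀ a → a < length W → at W a ≡ at (graft π ρ) (j + a) × at Wρ a ≡ at ρ (j + a) × j + a ∈ marked
    entry a lt = let a<m , j+a< = window-bound (graft π ρ) m j a lt in
      at-window (graft π ρ) m j a a<m , at-window ρ m j a a<m ,
      marked⁺ (subst (j + a <_) (graft-length π ρ) j+a<) (T-window-covered j∈ a<m)
    same : ∀ a b → a < length W → b < length W → (at W a <ᵇ at W b) ≡ (at Wρ a <ᵇ at Wρ b)
    same a b a< b< with entry a a< | entry b b<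
    ... | e₁ , e₂ , a∈ | e₃ , e₄ , b∈ rewrite e₁ | e₂ | e₃ | e₄ = graft-order {ρ = ρ} permπ a∈ b∈

  product-rule : ∀ S⁺ S⁻ T⁺ T⁻ → S⁺ ⊆ S → S⁻ ⊆ S → T⁺ ⊆ T → T⁻ ⊆ T →
    let E = Ev m σ S⁺ S⁻ ; F = Ev m σ T⁺ T⁻ in
    countᵇ (λ π → E π ∧ F π) (Sym n) * n ! ≡ countᵇ E (Sym n) * countᵇ F (Sym n)
  product-rule S⁺ S⁻ T⁺ T⁻ S⁺⊆ S⁻⊆ T⁺⊆ T⁻⊆ = sym (begin
    countᵇ E (Sym n) * countᵇ F (Sym n)
      ≡⟨ count-product E F (Sym n) (Sym n) ⟨
    countᵇ EF′ pairs
      ≡⟨ count-involution swap EF′ (cartesianProduct⁺ (Sym-unique n) (Sym-unique n)) swap-closed swap-involutive ⟩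
    countᵇ (λ x → EF′ (swap x)) pairs
      ≡⟨ count-cong _ _ swap-events ⟩
    countᵇ (λ x → E∧F (proj₁ x) ∧ true) pairs
      ≡⟨ count-product E∧F (λ _ → true) (Sym n) (Sym n) ⟩
    countᵇ E∧F (Sym n) * countᵇ (λ _ → true) (Sym n)
      ≡⟨ cong (countᵇ E∧F (Sym n) *_) (trans (count-true (Sym n)) (|Sym|≡! n)) ⟩
    countᵇ E∧F (Sym n) * n ! ∎)
    where
    open ≡-Reasoning
    open Pigeonhole (×-≡-dec (≡-dec _≟_) (≡-dec _≟_)) using (count-involution)
    E F E∧F : List ℕ → Bool
    E = Ev m σ S⁺ S⁻
    F = Ev m σ T⁺ T⁻
    E∧F π = E π ∧ F π
    pairs = cartesianProduct (Sym n) (Sym n)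
    EF′ : List ℕ × List ℕ → Bool
    EF′ (π , ρ) = E π ∧ F ρ
    -- exchange the order patterns of π and ρ on the covered positions
    swap : List ℕ × List ℕ → List ℕ × List ℕ
    swap (π , ρ) = graft π ρ , graft ρ π
    perms : ∀ {π ρ} → (π , ρ) ∈ pairs → IsPerm n π × IsPerm n ρ
    perms π,ρ∈ = Product.map Sym⁻ Sym⁻ (∈-cartesianProduct⁻ (Sym n) (Sym n) π,ρ∈)
    swap-closed : ∀ {x} → x ∈ pairs → swap x ∈ pairs
    swap-closed x∈ with perms x∈
    ... | permπ , permρ = ∈-cartesianProduct⁺ (Sym⁺ (graft-perm permπ permρ)) (Sym⁺ (graft-perm permρ permπ))
    swap-involutive : ∀ {x} → x ∈ pairs → swap (swap x) ≡ x
    swap-involutive x∈ with perms x∈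
    ... | permπ , permρ = cong₂ _,_ (graft-involutive permπ permρ) (graft-involutive permρ permπ)
    swap-events : ∀ {x} → x ∈ pairs → EF′ (swap x) ≡ E∧F (proj₁ x) ∧ true
    swap-events {π , ρ} x∈ with perms x∈
    ... | permπ , permρ = trans (cong₂ _∧_ keeps-E takes-F) (sym (∧-identityʳ _))
      where
      keeps-E : E (graft π ρ) ≡ E π
      keeps-E = Ev-cong m σ S⁺ S⁻ _ _ (λ i∈ → A-graft-S ρ (S⁺⊆ i∈) permπ) (λ i∈ → A-graft-S ρ (S⁻⊆ i∈) permπ)
      takes-F : F (graft ρ π) ≡ F π
      takes-F = Ev-cong m σ T⁺ T⁻ _ _ (λ j∈ → A-graft-T (T⁺⊆ j∈) permρ permπ) (λ j∈ → A-graft-T (T⁻⊆ j∈) permρ permπ)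

quotient-lemma : ∀ a b c N .{{_ : ℕ.NonZero N}} {{_ : ℚ.NonZero (+ b ℚ./ N)}} → a * N ≡ c * b →
                 (+ a ℚ./ N) ℚ.÷ (+ b ℚ./ N) ≡ + c ℚ./ N
quotient-lemma a b c (suc k) a*N≡c*b = begin
  x ℚ.÷ y               ≡⟨ cong (ℚ._* ℚ.1/ y) x≡z*y ⟩
  z ℚ.* y ℚ.* ℚ.1/ y    ≡⟨ ℚ.*-assoc z y (ℚ.1/ y) ⟩
  z ℚ.* (y ℚ.* ℚ.1/ y)  ≡⟨ cong (z ℚ.*_) (ℚ.*-inverseʳ y) ⟩
  z ℚ.* ℚ.1ℚ            ≡⟨ ℚ.*-identityʳ z ⟩
  z                     ∎
  where
  open ≡-Reasoning
  x = + a ℚ./ suc k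
  y = + b ℚ./ suc k
  z = + c ℚ./ suc k
  -- cross-multiplied form of  a/N = (c·b)/(N·N)
  cross : + a ℤ.* + (suc k * suc k) ≡ (+ c ℤ.* + b) ℤ.* + suc k
  cross = begin
    + a ℤ.* + (suc k * suc k)  ≡⟨ ℤ.pos-* a (suc k * suc k) ⟨
    + (a * (suc k * suc k))    ≡⟨ cong +_ (trans (sym (*-assoc a (suc k) (suc k))) (cong (_* suc k) a*N≡c*b)) ⟩
    + (c * b * suc k)          ≡⟨ ℤ.pos-* (c * b) (suc k) ⟩
    + (c * b) ℤ.* + suc k      ≡⟨ cong (ℤ._* + suc k) (ℤ.pos-* c b) ⟩
    (+ c ℤ.* + b) ℤ.* + suc k  ∎
  x≃z*y : ℚᵘ.mkℚᵘ (+ a) k ℚᵘ.≃ ℚ.toℚᵘ (z ℚ.* y)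
  x≃z*y = ℚᵘ.≃-trans (ℚᵘ.*≡* cross) (ℚᵘ.≃-sym (ℚᵘ.≃-trans (ℚ.toℚᵘ-homo-* z y)
            (ℚᵘ.*-cong (ℚ.toℚᵘ-fromℚᵘ (ℚᵘ.mkℚᵘ (+ c) k)) (ℚ.toℚᵘ-fromℚᵘ (ℚᵘ.mkℚᵘ (+ b) k)))))
  x≡z*y : x ≡ z ℚ.* y
  x≡z*y = trans (ℚ.fromℚᵘ-cong x≃z*y) (ℚ.fromℚᵘ-toℚᵘ (z ℚ.* y))

-- Conditioning on the T-events does not change the probability
-- of the S-events: by the product rule #(E∧F)·n! = #E·#F, and Pr = #/n!.
lemma1 : (n m : ℕ) (σ : List ℕ) → σ ∈ Sym m → m ≤ n →
         (S T : List ℕ) → All (_≤ n ∸ m) S → All (_≤ n ∸ m) T →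
         (∀ i → i ∈ S → i ∈ T → ⊥) →
         (∀ i j → i ∈ S → j ∈ T → m ≤ ∣ i - j ∣) →
         (S⁺ S⁻ T⁺ T⁻ : List ℕ) →
         S⁺ ⊆ S → S⁻ ⊆ S → (∀ i → i ∈ S⁺ → i ∈ S⁻ → ⊥) →
         T⁺ ⊆ T → T⁻ ⊆ T → (∀ j → j ∈ T⁺ → j ∈ T⁻ → ⊥) →
         {{_ : NonZero (Pr n (Ev m σ T⁺ T⁻))}} →
         CondPr n (Ev m σ S⁺ S⁻) (Ev m σ T⁺ T⁻) ≡ Pr n (Ev m σ S⁺ S⁻)
lemma1 n m σ _ _ S T _ _ _ separated S⁺ S⁻ T⁺ T⁻ S⁺⊆S S⁻⊆S _ T⁺⊆T T⁻⊆T _ =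
  quotient-lemma (countᵇ (λ π → Ev m σ S⁺ S⁻ π ∧ Ev m σ T⁺ T⁻ π) (Sym n)) (countᵇ (Ev m σ T⁺ T⁻) (Sym n))
                 (countᵇ (Ev m σ S⁺ S⁻) (Sym n)) (n !) {{n !≢0}}
                 (Separated.product-rule n m σ S T separated S⁺ S⁻ T⁺ T⁻ S⁺⊆S S⁻⊆S T⁺⊆T T⁻⊆T)
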